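{- Let $l,m\ge 2$ be integers with $l\mid m$. Then $g_m(n)\le g_l(n)$ for all $n\in\mathbb{N}$.
   Context: $\mathbb{N}=\{0,1,2,\dots\}$. For an integer $m\ge 2$, an $m$-product sequence is a finite sequence of integers $a_1\le a_2\le\dots\le a_t$ such that $\prod_{i=1}^t a_i=R^m$ for some $R\in\mathbb{N}$ and no integer appears more than $m-1$ times in the sequence. For $n\in\mathbb{N}$, $g_m(n)$ is the least integer $s$ such that there exists an $m$-product sequence $a_1\le\dots\le a_t$ with $a_1=n$ and $a_t=s$. -}

module Defs where

open import Data.Nat using (ℕ; zero; suc; _<_; _∸_)
open import Data.Integer using (ℤ; +_; _≤_; _*_; _^_; _≟_)
open import Data.List using (List; []; _∷_; foldr; last)
open import Data.List.Relation.Unary.Linked using (Linked)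
open import Data.Maybe using (just)
open import Data.Product using (∃; _×_)
open import Relation.Binary.PropositionalEquality using (_≡_)
open import Relation.Nullary using (yes; no)

productℤ : List ℤ → ℤ
productℤ = foldr _*_ (+ 1)

occ : ℤ → List ℤ → ℕ
occ x [] = 0
occ x (y ∷ ys) with x ≟ y
... | yes _ = suc (occ x ys)
... | no _  = occ x ys

record IsProductSeq (m : ℕ) (xs : List ℤ) : Set where
  field
    sorted   : Linked _≤_ xs
    perfect  : ∃ λ (R : ℕ) → productℤ xs ≡ (+ R) ^ m
    mult     : ∀ x → occ x xs < m

Attains : ℕ → ℕ → ℤ → Set
Attains m n s = ∃ λ (rest : List ℤ) →
  IsProductSeq m ((+ n) ∷ rest) × (last ((+ n) ∷ rest) ≡ just s)

-- s is g_m(n): attained, and least among attained values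
IsG : ℕ → ℕ → ℤ → Set
IsG m n s = Attains m n s × (∀ s' → Attains m n s' → s ≤ s')

module Submission where

-- Write m = d·l. Repeating every term of an l-product sequence d times keeps it sorted
-- and keeps its first and last terms; the product R^l becomes R^m, and every
-- multiplicity, being below l, is multiplied by d and so stays below m. So every last
-- term of an l-product sequence starting at n is also one of an m-product sequence.

open import Defs
open import Data.Nat using (ℕ; _≥_)
open import Data.Nat.Divisibility using (_∣_)
open import Data.Integer using (ℤ; _≤_)

open import Data.Integer using (+_; _*_; _^_; _≟_)
import Data.Integer.Properties as ℤ
open import Data.List using (List; []; _∷_; [_]; _++_; replicate; concatMap; last)
open import Data.List.Relation.Unary.Linked using (Linked; []; [-]; _∷_)
open import Data.Nat using (zero; suc; _+_; _<_) renaming (_*_ to _*ℕ_)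
open import Data.Nat.Divisibility using (divides)
import Data.Nat.Properties as ℕ
open import Data.Product using (_,_)
open import Level using (Level)
open import Relation.Binary.Core using (Rel)
open import Relation.Binary.Definitions using (Reflexive)
open import Relation.Binary.PropositionalEquality using (_≡_; refl; sym; trans; cong; cong₂; subst; module ≡-Reasoning)
open import Relation.Nullary using (yes; no)

open import Algebra.Properties.CommutativeSemigroup ℤ.*-commutativeSemigroup using (interchange)

private
  variable
    a r : Level
    A : Set a

stretch : ℕ → List A → List A
stretch d = concatMap (replicate d)

module _ {R : Rel A r} (refl-R : Reflexive R) where

  replicate-linked : ∀ j {x ys} → Linked R (x ∷ ys) → Linked R (x ∷ replicate j x ++ ys)
  replicate-linked zero    p = p
  replicate-linked (suc j) p = refl-R ∷ replicate-linked j p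

  stretch-linked : ∀ k {xs} → Linked R xs → Linked R (stretch (suc k) xs)
  stretch-linked k []      = []
  stretch-linked k [-]     = replicate-linked k [-]
  stretch-linked k (r ∷ p) = replicate-linked k (r ∷ stretch-linked k p)

last-replicate : ∀ j (x : A) ys → last (x ∷ replicate j x ++ ys) ≡ last (x ∷ ys)
last-replicate zero    x ys = refl
last-replicate (suc j) x ys = last-replicate j x ys

last-stretch : ∀ k (x : A) xs → last (stretch (suc k) (x ∷ xs)) ≡ last (x ∷ xs)
last-stretch k x []       = last-replicate k x []
last-stretch k x (y ∷ ys) = trans (last-replicate k x _) (last-stretch k y ys)

^-distrib-* : ∀ x y n → (x * y) ^ n ≡ x ^ n * y ^ n
^-distrib-* x y zero    = refl
^-distrib-* x y (suc n) = begin
  (x * y) * (x * y) ^ n     ≡⟨ cong ((x * y) *_) (^-distrib-* x y n) ⟩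
  (x * y) * (x ^ n * y ^ n) ≡⟨ interchange x y (x ^ n) (y ^ n) ⟩
  (x * x ^ n) * (y * y ^ n) ∎
  where open ≡-Reasoning

productℤ-++ : ∀ xs ys → productℤ (xs ++ ys) ≡ productℤ xs * productℤ ys
productℤ-++ []       ys = sym (ℤ.*-identityˡ _)
productℤ-++ (x ∷ xs) ys = begin
  x * productℤ (xs ++ ys)          ≡⟨ cong (x *_) (productℤ-++ xs ys) ⟩
  x * (productℤ xs * productℤ ys)  ≡⟨ sym (ℤ.*-assoc x _ _) ⟩
  (x * productℤ xs) * productℤ ys  ∎
  where open ≡-Reasoning

productℤ-replicate : ∀ d x → productℤ (replicate d x) ≡ x ^ d
productℤ-replicate zero    x = refl
productℤ-replicate (suc d) x = cong (x *_) (productℤ-replicate d x)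

productℤ-stretch : ∀ d xs → productℤ (stretch d xs) ≡ productℤ xs ^ d
productℤ-stretch d []       = sym (ℤ.^-zeroˡ d)
productℤ-stretch d (x ∷ xs) = begin
  productℤ (replicate d x ++ stretch d xs)           ≡⟨ productℤ-++ (replicate d x) _ ⟩
  productℤ (replicate d x) * productℤ (stretch d xs) ≡⟨ cong₂ _*_ (productℤ-replicate d x) (productℤ-stretch d xs) ⟩
  x ^ d * productℤ xs ^ d                            ≡⟨ sym (^-distrib-* x (productℤ xs) d) ⟩
  (x * productℤ xs) ^ d                              ∎
  where open ≡-Reasoning

occ-++ : ∀ x xs ys → occ x (xs ++ ys) ≡ occ x xs + occ x ys
occ-++ x []       ys = refl
occ-++ x (y ∷ xs) ys with x ≟ y
... | yes _ = cong suc (occ-++ x xs ys)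
... | no  _ = occ-++ x xs ys

occ-replicate : ∀ x d y → occ x (replicate d y) ≡ d *ℕ occ x [ y ]
occ-replicate x zero    y = refl
occ-replicate x (suc d) y = begin
  occ x ([ y ] ++ replicate d y)      ≡⟨ occ-++ x [ y ] _ ⟩
  occ x [ y ] + occ x (replicate d y) ≡⟨ cong (λ t → occ x [ y ] + t) (occ-replicate x d y) ⟩
  occ x [ y ] + d *ℕ occ x [ y ]      ∎
  where open ≡-Reasoning

occ-stretch : ∀ x d xs → occ x (stretch d xs) ≡ d *ℕ occ x xs
occ-stretch x d []       = sym (ℕ.*-zeroʳ d)
occ-stretch x d (y ∷ ys) = begin
  occ x (replicate d y ++ stretch d ys)        ≡⟨ occ-++ x (replicate d y) _ ⟩
  occ x (replicate d y) + occ x (stretch d ys) ≡⟨ cong₂ _+_ (occ-replicate x d y) (occ-stretch x d ys) ⟩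
  d *ℕ occ x [ y ] + d *ℕ occ x ys             ≡⟨ sym (ℕ.*-distribˡ-+ d (occ x [ y ]) _) ⟩
  d *ℕ (occ x [ y ] + occ x ys)                ≡⟨ cong (d *ℕ_) (sym (occ-++ x [ y ] ys)) ⟩
  d *ℕ occ x (y ∷ ys)                          ∎
  where open ≡-Reasoning

stretch-isProductSeq : ∀ k l xs → IsProductSeq l xs → IsProductSeq (suc k *ℕ l) (stretch (suc k) xs)
stretch-isProductSeq k l xs record { sorted = sorted ; perfect = (root , product≡) ; mult = mult } =
  record
  { sorted  = stretch-linked ℤ.≤-refl k sorted
  ; perfect = root , stretched-product≡
  ; mult    = λ y → subst (_< suc k *ℕ l) (sym (occ-stretch y (suc k) xs))
                      (ℕ.*-monoʳ-< (suc k) (mult y))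
  }
  where
  stretched-product≡ : productℤ (stretch (suc k) xs) ≡ (+ root) ^ (suc k *ℕ l)
  stretched-product≡ = begin
    productℤ (stretch (suc k) xs) ≡⟨ productℤ-stretch (suc k) xs ⟩
    productℤ xs ^ suc k           ≡⟨ cong (_^ suc k) product≡ ⟩
    ((+ root) ^ l) ^ suc k        ≡⟨ ℤ.^-*-assoc (+ root) l (suc k) ⟩
    (+ root) ^ (l *ℕ suc k)       ≡⟨ cong ((+ root) ^_) (ℕ.*-comm l (suc k)) ⟩
    (+ root) ^ (suc k *ℕ l)       ∎
    where open ≡-Reasoning

stretch-attains : ∀ k {l n s} → Attains l n s → Attains (suc k *ℕ l) n s
stretch-attains k {n = n} (rest , ps , last≡s) =
  _ , stretch-isProductSeq k _ (+ n ∷ rest) ps , trans (last-stretch k (+ n) rest) last≡s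

lemma4p9 : (l m : ℕ) → l ≥ 2 → m ≥ 2 → l ∣ m →
    (n : ℕ) (a b : ℤ) → IsG m n a → IsG l n b → a ≤ b
lemma4p9 l .(zero *ℕ l)  _ () (divides zero refl)
lemma4p9 l .(suc k *ℕ l) _ _  (divides (suc k) refl) n a b (_ , a-least) (b-attained , _) =
  a-least b (stretch-attains k b-attained)
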